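{- Let $d,k\ge 1$ and $n$ be integers, let $\ell_i = n^{\frac{d^k-d^i}{d^k-1}}$ for $0\le i<k$ (assumed integers), and let $m=\sum_{0\le i<k}\ell_i$. For $0\le i<k$ and every point $\vec{y}\in[m]^d$, $$\sum_{\vec{x}\in[m]^d}\frac{|B_i(\vec{x},\vec{y})|}{\ell_i^d}\le d\cdot \ell_i .$$
   Context: $[m]=\{1,\dots,m\}$. For $\vec{x}=(x_1,\dots,x_d)\in[m]^d$, $W_i(\vec{x})=\{\vec{y}\in[m]^d: x_j\le y_j< x_j+\ell_i\ \forall j\in[d]\}$. For $\vec{x},\vec{y}\in[m]^d$ and $1\le j\le d$, let $E_j(\vec{x},\vec{y})=\{(y_1,\dots,y_{j-1},z_j,x_{j+1},\dots,x_d)\in[m]^d:\min(x_j,y_j)\le z_j\le\max(x_j,y_j)\}$, and the folded segment is $FS(\vec{x},\vec{y})=\bigl(\bigcup_{j\in[d]}E_j(\vec{x},\vec{y})\bigr)\setminus\{\vec{x}\}$. Finally $B_i(\vec{x},\vec{y})=\{\vec{z}\in W_i(\vec{x}):\vec{y}\in FS(\vec{x},\vec{z})\}$. -}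

module Defs where

open import Data.Nat using (ℕ; _≤_; _<_; _+_; _⊓_; _⊔_)
open import Data.Nat.Properties using (_≤?_; _<?_) renaming (_≟_ to _≟ℕ_)
open import Data.Fin using (Fin; toℕ) renaming (_≟_ to _≟F_)
open import Data.Fin.Properties using (all?; any?)
open import Data.Vec using (Vec; []; _∷_; lookup)
open import Data.Vec.Properties using (≡-dec)
open import Data.List using (List; []; _∷_; map; concatMap; applyUpTo; filter; length)
open import Data.Nat.ListAction using (sum)
open import Data.Product using (_×_; ∃; _,_)
open import Relation.Nullary using (Dec; ¬_)
open import Relation.Nullary.Decidable using (_×-dec_; _→-dec_; ¬?)
open import Relation.Binary.PropositionalEquality using (_≡_; _≢_)

Point : ℕ → Set
Point d = Vec ℕ d

InCube : {d : ℕ} → ℕ → Point d → Set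
InCube m x = ∀ p → 1 ≤ lookup x p × lookup x p ≤ m

cube : ℕ → (d : ℕ) → List (Point d)
cube m Data.Nat.zero = [] ∷ []
cube m (Data.Nat.suc d) = concatMap (λ a → map (a ∷_) (cube m d)) (applyUpTo Data.Nat.suc m)

-- y ∈ W(x) for window side l (W_i uses l = ℓ_i), inside [m]^d
InW : {d : ℕ} → ℕ → ℕ → Point d → Point d → Set
InW m l x y = InCube m y × (∀ p → lookup x p ≤ lookup y p × lookup y p < lookup x p + l)

InE : {d : ℕ} → ℕ → Fin d → Point d → Point d → Point d → Set
InE m j x y w = InCube m w ×
  (∀ p → (toℕ p < toℕ j → lookup w p ≡ lookup y p)
       × (p ≡ j → (lookup x j ⊓ lookup y j) ≤ lookup w p × lookup w p ≤ (lookup x j ⊔ lookup y j))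
       × (toℕ j < toℕ p → lookup w p ≡ lookup x p))

InFS : {d : ℕ} → ℕ → Point d → Point d → Point d → Set
InFS m x y w = (∃ λ j → InE m j x y w) × w ≢ x

InB : {d : ℕ} → ℕ → ℕ → Point d → Point d → Point d → Set
InB m l x y z = InW m l x z × InFS m x z y

inCube? : {d : ℕ} → (m : ℕ) → (x : Point d) → Dec (InCube m x)
inCube? m x = all? (λ p → (1 ≤? lookup x p) ×-dec (lookup x p ≤? m))

inW? : {d : ℕ} → (m l : ℕ) → (x y : Point d) → Dec (InW m l x y)
inW? m l x y = inCube? m y ×-dec all? (λ p → (lookup x p ≤? lookup y p) ×-dec (lookup y p <? lookup x p + l))

inE? : {d : ℕ} → (m : ℕ) → (j : Fin d) → (x y w : Point d) → Dec (InE m j x y w)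
inE? m j x y w = inCube? m w ×-dec all? (λ p →
    ((toℕ p <? toℕ j) →-dec (lookup w p ≟ℕ lookup y p))
    ×-dec ((p ≟F j) →-dec (((lookup x j ⊓ lookup y j) ≤? lookup w p) ×-dec (lookup w p ≤? (lookup x j ⊔ lookup y j))))
    ×-dec ((toℕ j <? toℕ p) →-dec (lookup w p ≟ℕ lookup x p)))

inFS? : {d : ℕ} → (m : ℕ) → (x y w : Point d) → Dec (InFS m x y w)
inFS? m x y w = any? (λ j → inE? m j x y w) ×-dec ¬? (≡-dec _≟ℕ_ w x)

inB? : {d : ℕ} → (m l : ℕ) → (x y z : Point d) → Dec (InB m l x y z)
inB? m l x y z = inW? m l x z ×-dec inFS? m x z y

cardB : {d : ℕ} → (m l : ℕ) → Point d → Point d → ℕ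
cardB {d} m l x y = length (filter (λ z → inB? m l x y z) (cube m d))

sumB : (d : ℕ) → (m l : ℕ) → Point d → ℕ
sumB d m l y = sum (map (λ x → cardB m l x y) (cube m d))

-- For z ∈ W(x), the point y lies in FS(x,z) only if y ∈ E_j(x,z) for some j, and this pins down
-- every coordinate: y_p = z_p for p < j, x_j ≤ y_j ≤ z_j, and y_p = x_p for p > j, while always
-- x_p ≤ z_p < x_p + ℓ. With y fixed, each coordinate p ≠ j then admits at most ℓ pairs (x_p, z_p)
-- and the coordinate j at most ℓ², so each j accounts for at most ℓ^(d+1) pairs (x, z). Counting
-- with multiplicity over j makes the count factorise over coordinates, and the total is d·ℓ^(d+1).
module Submission where

open import Defs
open import Data.Empty using (⊥-elim)
open import Data.Fin using (Fin) renaming (zero to fzero; suc to fsuc)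
open import Data.List using (List; []; _∷_; map; upTo; concatMap; applyUpTo; filter; length; _++_)
open import Data.List.Properties using (map-++; map-∘)
open import Data.Nat using (ℕ; zero; suc; _≤_; _<_; _+_; _*_; _^_; _∸_; _⊔_; z≤n; s≤s)
open import Data.Nat.ListAction using (sum)
open import Data.Nat.ListAction.Properties using (sum-++)
open import Data.Nat.Properties
open import Algebra.Properties.CommutativeSemigroup +-commutativeSemigroup using (interchange)
open import Data.Nat.Solver using (module +-*-Solver)
open import Data.Product using (_×_; _,_; proj₁; proj₂)
open import Data.Vec using ([]; _∷_; head; tail; lookup)
open import Function using (_∘_)
open import Relation.Nullary using (Dec; yes; no)
open import Relation.Nullary.Decidable using (_×-dec_)
open import Relation.Unary using (Pred; Decidable)
open import Relation.Binary.PropositionalEquality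

𝟙 : ∀ {a} {P : Set a} → Dec P → ℕ
𝟙 (yes _) = 1
𝟙 (no _)  = 0

1≤𝟙 : ∀ {a} {P : Set a} → P → (p : Dec P) → 1 ≤ 𝟙 p
1≤𝟙 _ (yes _) = s≤s z≤n
1≤𝟙 x (no ¬x) = ⊥-elim (¬x x)

𝟙≤𝟙*𝟙 : ∀ {a b c} {P : Set a} {Q : Set b} {R : Set c} → (P → Q × R) →
        (p : Dec P) (q : Dec Q) (r : Dec R) → 𝟙 p ≤ 𝟙 q * 𝟙 r
𝟙≤𝟙*𝟙 _ (no _)  _       _       = z≤n
𝟙≤𝟙*𝟙 _ (yes _) (yes _) (yes _) = s≤s z≤n
𝟙≤𝟙*𝟙 f (yes x) (no ¬q) _       = ⊥-elim (¬q (proj₁ (f x)))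
𝟙≤𝟙*𝟙 f (yes x) (yes _) (no ¬r) = ⊥-elim (¬r (proj₂ (f x)))

private variable A B : Set

∑ : List A → (A → ℕ) → ℕ
∑ L f = sum (map f L)

syntax ∑ L (λ a → e) = ∑[ a ∈ L ] e

∑-cong : (L : List A) {f g : A → ℕ} → (∀ a → f a ≡ g a) → ∑ L f ≡ ∑ L g
∑-cong []      f≡g = refl
∑-cong (a ∷ L) f≡g = cong₂ _+_ (f≡g a) (∑-cong L f≡g)

∑-mono-≤ : (L : List A) {f g : A → ℕ} → (∀ a → f a ≤ g a) → ∑ L f ≤ ∑ L g
∑-mono-≤ []      f≤g = z≤n
∑-mono-≤ (a ∷ L) f≤g = +-mono-≤ (f≤g a) (∑-mono-≤ L f≤g)

∑-+ : (L : List A) (f g : A → ℕ) → ∑[ a ∈ L ] (f a + g a) ≡ ∑ L f + ∑ L g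
∑-+ []      f g = refl
∑-+ (a ∷ L) f g =
  trans (cong (f a + g a +_) (∑-+ L f g)) (interchange (f a) (g a) (∑ L f) (∑ L g))

∑-*ˡ : (L : List A) (k : ℕ) (f : A → ℕ) → ∑[ a ∈ L ] (k * f a) ≡ k * ∑ L f
∑-*ˡ []      k f = sym (*-zeroʳ k)
∑-*ˡ (a ∷ L) k f = trans (cong (k * f a +_) (∑-*ˡ L k f)) (sym (*-distribˡ-+ k (f a) _))

∑-*ʳ : (L : List A) (k : ℕ) (f : A → ℕ) → ∑[ a ∈ L ] (f a * k) ≡ ∑ L f * k
∑-*ʳ L k f = trans (∑-cong L (λ a → *-comm (f a) k)) (trans (∑-*ˡ L k f) (*-comm k _))

∑-++ : (L M : List A) (f : A → ℕ) → ∑ (L ++ M) f ≡ ∑ L f + ∑ M f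
∑-++ L M f = trans (cong sum (map-++ f L M)) (sum-++ (map f L) (map f M))

∑-map : (L : List A) (h : A → B) (f : B → ℕ) → ∑ (map h L) f ≡ ∑[ a ∈ L ] f (h a)
∑-map L h f = cong sum (sym (map-∘ L))

∑-concatMap : (L : List A) (g : A → List B) (f : B → ℕ) →
              ∑ (concatMap g L) f ≡ ∑[ a ∈ L ] ∑ (g a) f
∑-concatMap []      g f = refl
∑-concatMap (a ∷ L) g f =
  trans (∑-++ (g a) (concatMap g L) f) (cong (∑ (g a) f +_) (∑-concatMap L g f))

∑-∑-* : (L : List A) (M : List B) (f : A → ℕ) (g : B → ℕ) →
        ∑[ a ∈ L ] ∑[ b ∈ M ] (f a * g b) ≡ ∑ L f * ∑ M g
∑-∑-* L M f g = trans (∑-cong L (λ a → ∑-*ˡ M (f a) g)) (∑-*ʳ L (∑ M g) f)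

length-filter≤∑ : ∀ {p} {P : Pred A p} (P? : Decidable P) (g : A → ℕ) (L : List A) →
                  (∀ a → P a → 1 ≤ g a) → length (filter P? L) ≤ ∑ L g
length-filter≤∑ P? g []      P⇒1≤g = z≤n
length-filter≤∑ P? g (a ∷ L) P⇒1≤g with P? a
... | yes Pa = +-mono-≤ (P⇒1≤g a Pa) (length-filter≤∑ P? g L P⇒1≤g)
... | no _   = ≤-trans (length-filter≤∑ P? g L P⇒1≤g) (m≤n+m _ _)

∑∑ : List A → (A → A → ℕ) → ℕ
∑∑ L F = ∑[ a ∈ L ] ∑[ b ∈ L ] F a b

∑∑-+ : (L : List A) (F G : A → A → ℕ) → ∑∑ L (λ a b → F a b + G a b) ≡ ∑∑ L F + ∑∑ L G
∑∑-+ L F G = trans (∑-cong L (λ a → ∑-+ L (F a) (G a))) (∑-+ L _ _)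

∑∑-≤-* : (L : List A) {F : A → A → ℕ} (f g : A → ℕ) →
         (∀ a b → F a b ≤ f a * g b) → ∑∑ L F ≤ ∑ L f * ∑ L g
∑∑-≤-* L f g F≤f*g =
  ≤-trans (∑-mono-≤ L (λ a → ∑-mono-≤ L (F≤f*g a))) (≤-reflexive (∑-∑-* L L f g))

[1…_] : ℕ → List ℕ
[1… m ] = applyUpTo suc m

∑-cube-suc : ∀ m d (F : Point (suc d) → ℕ) →
             ∑ (cube m (suc d)) F ≡ ∑[ a ∈ [1… m ] ] ∑[ x ∈ cube m d ] F (a ∷ x)
∑-cube-suc m d F = trans (∑-concatMap [1… m ] (λ a → map (a ∷_) (cube m d)) F)
                         (∑-cong [1… m ] (λ a → ∑-map (cube m d) (a ∷_) F))

∑∑-cube-suc-* : ∀ m d (p : ℕ → ℕ → ℕ) (U : Point d → Point d → ℕ) →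
  ∑∑ (cube m (suc d)) (λ x z → p (head x) (head z) * U (tail x) (tail z))
  ≡ ∑∑ [1… m ] p * ∑∑ (cube m d) U
∑∑-cube-suc-* m d p U = begin
    ∑∑ (cube m (suc d)) (λ x z → p (head x) (head z) * U (tail x) (tail z))
  ≡⟨ ∑-cube-suc m d _ ⟩
    ∑[ a ∈ [1… m ] ] ∑[ x ∈ cube m d ] ∑[ z ∈ cube m (suc d) ] (p a (head z) * U x (tail z))
  ≡⟨ ∑-cong [1… m ] (λ a → ∑-cong (cube m d) (λ x → ∑-cube-suc m d _)) ⟩
    ∑[ a ∈ [1… m ] ] ∑[ x ∈ cube m d ] ∑[ b ∈ [1… m ] ] ∑[ z ∈ cube m d ] (p a b * U x z)
  ≡⟨ ∑-cong [1… m ] (λ a → ∑-cong (cube m d) (λ x → ∑-∑-* [1… m ] (cube m d) (p a) (U x))) ⟩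
    ∑[ a ∈ [1… m ] ] ∑[ x ∈ cube m d ] (∑ [1… m ] (p a) * ∑ (cube m d) (U x))
  ≡⟨ ∑-∑-* [1… m ] (cube m d) _ _ ⟩
    ∑∑ [1… m ] p * ∑∑ (cube m d) U ∎
  where open ≡-Reasoning

Between : ℕ → ℕ → ℕ → Set
Between u t a = u ≤ a × a < t

between? : ∀ u t a → Dec (Between u t a)
between? u t a = (u ≤? a) ×-dec (a <? t)

∑-between-applyUpTo : (f : ℕ → ℕ) → (∀ i → f (suc i) ≡ suc (f i)) → ∀ n u t →
                      ∑[ a ∈ applyUpTo f n ] 𝟙 (between? u t a) ≤ t ∸ (u ⊔ f 0)
∑-between-applyUpTo f f-suc zero    u t = z≤n
∑-between-applyUpTo f f-suc (suc n) u t
  with ih ← subst (λ s → ∑[ a ∈ applyUpTo (f ∘ suc) n ] 𝟙 (between? u t a) ≤ t ∸ (u ⊔ s))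
                 (f-suc 0) (∑-between-applyUpTo (f ∘ suc) (f-suc ∘ suc) n u t)
     | between? u t (f 0)
... | yes (u≤s , s<t) = begin
    1 + ∑[ a ∈ applyUpTo (f ∘ suc) n ] 𝟙 (between? u t a)  ≤⟨ +-monoʳ-≤ 1 ih ⟩
    1 + (t ∸ (u ⊔ suc (f 0)))                             ≡⟨ cong (λ s → 1 + (t ∸ s)) (m≤n⇒m⊔n≡n (m≤n⇒m≤1+n u≤s)) ⟩
    1 + (t ∸ suc (f 0))                                   ≡⟨ sym (+-∸-assoc 1 s<t) ⟩
    t ∸ f 0                                               ≡⟨ cong (t ∸_) (sym (m≤n⇒m⊔n≡n u≤s)) ⟩
    t ∸ (u ⊔ f 0)                                         ∎
  where open ≤-Reasoning
... | no _ = ≤-trans ih (∸-monoʳ-≤ t (⊔-monoʳ-≤ u (n≤1+n (f 0))))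

∑-between≤ : ∀ m u t → ∑[ a ∈ [1… m ] ] 𝟙 (between? u t a) ≤ t ∸ u
∑-between≤ m u t = ≤-trans (∑-between-applyUpTo suc (λ _ → refl) m u t) (∸-monoʳ-≤ t (m≤m⊔n u 1))

∑-between-+≤ : ∀ m u w → ∑[ a ∈ [1… m ] ] 𝟙 (between? u (u + w) a) ≤ w
∑-between-+≤ m u w = ≤-trans (∑-between≤ m u (u + w)) (≤-reflexive (m+n∸m≡n u w))

∑-between-∸≤ : ∀ m t w → ∑[ a ∈ [1… m ] ] 𝟙 (between? (t ∸ w) t a) ≤ w
∑-between-∸≤ m t w = ≤-trans (∑-between≤ m (t ∸ w) t)
  (m≤n+o⇒m∸n≤o t (t ∸ w) (≤-trans (m≤n+m∸n t w) (≤-reflexive (+-comm w (t ∸ w)))))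

Window : ℕ → ℕ → ℕ → Set
Window l a b = a ≤ b × b < a + l

At Before After : ℕ → ℕ → ℕ → ℕ → Set
At     l a b c = a ≤ c × c ≤ b × b < a + l
Before l a b c = c ≡ b × Window l a b
After  l a b c = c ≡ a × Window l a b

at? : ∀ l a b c → Dec (At l a b c)
at? l a b c = (a ≤? c) ×-dec (c ≤? b) ×-dec (b <? a + l)

before? : ∀ l a b c → Dec (Before l a b c)
before? l a b c = (c ≟ b) ×-dec (a ≤? b) ×-dec (b <? a + l)

after? : ∀ l a b c → Dec (After l a b c)
after? l a b c = (c ≟ a) ×-dec (a ≤? b) ×-dec (b <? a + l)

m<n+o⇒1+m∸o≤n : ∀ {m n} o → m < n + o → suc m ∸ o ≤ n
m<n+o⇒1+m∸o≤n {n = n} o m<n+o = ≤-trans (∸-monoˡ-≤ o m<n+o) (≤-reflexive (m+n∸n≡m n o))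

∑∑-at≤ : ∀ m l c → ∑∑ [1… m ] (λ a b → 𝟙 (at? l a b c)) ≤ l * l
∑∑-at≤ m l c = ≤-trans
  (∑∑-≤-* [1… m ] _ _ (λ a b →
     𝟙≤𝟙*𝟙 split (at? l a b c) (between? (suc c ∸ l) (suc c) a) (between? c (c + l) b)))
  (*-mono-≤ (∑-between-∸≤ m (suc c) l) (∑-between-+≤ m c l))
  where
  split : ∀ {a b} → At l a b c → Between (suc c ∸ l) (suc c) a × Between c (c + l) b
  split (a≤c , c≤b , b<a+l) =
    (m<n+o⇒1+m∸o≤n l (≤-<-trans c≤b b<a+l) , s≤s a≤c) , (c≤b , <-≤-trans b<a+l (+-monoˡ-≤ l a≤c))

∑∑-before≤ : ∀ m l c → ∑∑ [1… m ] (λ a b → 𝟙 (before? l a b c)) ≤ l * 1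
∑∑-before≤ m l c = ≤-trans
  (∑∑-≤-* [1… m ] _ _ (λ a b →
     𝟙≤𝟙*𝟙 split (before? l a b c) (between? (suc c ∸ l) (suc c) a) (between? c (suc c) b)))
  (*-mono-≤ (∑-between-∸≤ m (suc c) l) (∑-between-∸≤ m (suc c) 1))
  where
  split : ∀ {a b} → Before l a b c → Between (suc c ∸ l) (suc c) a × Between c (suc c) b
  split (refl , a≤c , c<a+l) = (m<n+o⇒1+m∸o≤n l c<a+l , s≤s a≤c) , (≤-refl , ≤-refl)

∑∑-after≤ : ∀ m l c → ∑∑ [1… m ] (λ a b → 𝟙 (after? l a b c)) ≤ 1 * l
∑∑-after≤ m l c = ≤-trans
  (∑∑-≤-* [1… m ] _ _ (λ a b →
     𝟙≤𝟙*𝟙 split (after? l a b c) (between? c (suc c) a) (between? c (c + l) b)))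
  (*-mono-≤ (∑-between-∸≤ m (suc c) 1) (∑-between-+≤ m c l))
  where
  split : ∀ {a b} → After l a b c → Between c (suc c) a × Between c (c + l) b
  split (refl , window) = (≤-refl , ≤-refl) , window

afterWeight : ℕ → ∀ {d} → Point d → Point d → Point d → ℕ
afterWeight l {zero}  x z y = 1
afterWeight l {suc d} x z y =
  𝟙 (after? l (head x) (head z) (head y)) * afterWeight l (tail x) (tail z) (tail y)

-- foldWeight l x z y = ∑_j ∏_p [(x_p, z_p, y_p) is Before, At or After as p <, = or > j],
-- an upper bound for [z ∈ W(x) and y ∈ FS(x,z)] that factorises over the coordinates.
foldWeight : ℕ → ∀ {d} → Point d → Point d → Point d → ℕ
foldWeight l {zero}  x z y = 0
foldWeight l {suc d} x z y =
    𝟙 (at? l (head x) (head z) (head y)) * afterWeight l (tail x) (tail z) (tail y)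
  + 𝟙 (before? l (head x) (head z) (head y)) * foldWeight l (tail x) (tail z) (tail y)

Windowed : ℕ → ∀ {d} → Point d → Point d → Set
Windowed l x z = ∀ p → Window l (lookup x p) (lookup z p)

1≤afterWeight : ∀ l {d} (x z y : Point d) → Windowed l x z →
                (∀ p → lookup y p ≡ lookup x p) → 1 ≤ afterWeight l x z y
1≤afterWeight l []      []      []      _      _    = ≤-refl
1≤afterWeight l (a ∷ x) (b ∷ z) (c ∷ y) window y≡x =
  *-mono-≤ (1≤𝟙 (y≡x fzero , window fzero) (after? l a b c))
           (1≤afterWeight l x z y (window ∘ fsuc) (y≡x ∘ fsuc))

InE-suc : ∀ {m d} {j : Fin d} {a b c} {x z y : Point d} →
          InE m (fsuc j) (a ∷ x) (b ∷ z) (c ∷ y) → InE m j x z y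
InE-suc (y∈cube , e) = y∈cube ∘ fsuc , λ p →
    (λ p<j → proj₁ (e (fsuc p)) (s≤s p<j))
  , (λ p≡j → proj₁ (proj₂ (e (fsuc p))) (cong fsuc p≡j))
  , (λ j<p → proj₂ (proj₂ (e (fsuc p))) (s≤s j<p))

1≤foldWeight : ∀ {m} l {d} (j : Fin d) (x z y : Point d) → Windowed l x z →
               InE m j x z y → 1 ≤ foldWeight l x z y
1≤foldWeight l fzero (a ∷ x) (b ∷ z) (c ∷ y) window (_ , e) =
  ≤-trans (*-mono-≤ (1≤𝟙 (a≤c , c≤b , proj₂ (window fzero)) (at? l a b c))
                    (1≤afterWeight l x z y (window ∘ fsuc) (λ p → proj₂ (proj₂ (e (fsuc p))) (s≤s z≤n))))
          (m≤m+n _ _)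
  where
  a≤b = proj₁ (window fzero)
  a⊓b≤c×c≤a⊔b = proj₁ (proj₂ (e fzero)) refl
  a≤c = subst (_≤ c) (m≤n⇒m⊓n≡m a≤b) (proj₁ a⊓b≤c×c≤a⊔b)
  c≤b = subst (c ≤_) (m≤n⇒m⊔n≡n a≤b) (proj₂ a⊓b≤c×c≤a⊔b)
1≤foldWeight l (fsuc j) (a ∷ x) (b ∷ z) (c ∷ y) window y∈E =
  ≤-trans (*-mono-≤ (1≤𝟙 (proj₁ (proj₂ y∈E fzero) (s≤s z≤n) , window fzero) (before? l a b c))
                    (1≤foldWeight l j x z y (window ∘ fsuc) (InE-suc y∈E)))
          (m≤n+m _ _)

cardB≤∑foldWeight : ∀ m l {d} (x y : Point d) → cardB m l x y ≤ ∑[ z ∈ cube m d ] foldWeight l x z y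
cardB≤∑foldWeight m l {d} x y = length-filter≤∑ (inB? m l x y) _ (cube m d)
  λ { z ((_ , window) , ((j , y∈E) , _)) → 1≤foldWeight l j x z y window y∈E }

∑∑-afterWeight≤ : ∀ m l d (y : Point d) → ∑∑ (cube m d) (λ x z → afterWeight l x z y) ≤ l ^ d
∑∑-afterWeight≤ m l zero    y = ≤-refl
∑∑-afterWeight≤ m l (suc d) y = begin
    ∑∑ (cube m (suc d)) (λ x z → afterWeight l x z y)
  ≡⟨ ∑∑-cube-suc-* m d _ _ ⟩
    ∑∑ [1… m ] (λ a b → 𝟙 (after? l a b (head y))) * ∑∑ (cube m d) (λ x z → afterWeight l x z (tail y))
  ≤⟨ *-mono-≤ (∑∑-after≤ m l (head y)) (∑∑-afterWeight≤ m l d (tail y)) ⟩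
    1 * l * l ^ d
  ≡⟨ cong (_* l ^ d) (*-identityˡ l) ⟩
    l ^ suc d ∎
  where open ≤-Reasoning

∑∑-foldWeight≤ : ∀ m l d (y : Point d) → ∑∑ (cube m d) (λ x z → foldWeight l x z y) ≤ d * l * l ^ d
∑∑-foldWeight≤ m l zero    y = ≤-refl
∑∑-foldWeight≤ m l (suc d) y = begin
    ∑∑ (cube m (suc d)) (λ x z → foldWeight l x z y)
  ≡⟨ ∑∑-+ (cube m (suc d)) _ _ ⟩
    ∑∑ (cube m (suc d)) (λ x z → 𝟙 (at? l (head x) (head z) c) * afterWeight l (tail x) (tail z) y′)
    + ∑∑ (cube m (suc d)) (λ x z → 𝟙 (before? l (head x) (head z) c) * foldWeight l (tail x) (tail z) y′)
  ≡⟨ cong₂ _+_ (∑∑-cube-suc-* m d _ _) (∑∑-cube-suc-* m d _ _) ⟩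
    ∑∑ [1… m ] (λ a b → 𝟙 (at? l a b c)) * ∑∑ (cube m d) (λ x z → afterWeight l x z y′)
    + ∑∑ [1… m ] (λ a b → 𝟙 (before? l a b c)) * ∑∑ (cube m d) (λ x z → foldWeight l x z y′)
  ≤⟨ +-mono-≤ (*-mono-≤ (∑∑-at≤ m l c) (∑∑-afterWeight≤ m l d y′))
               (*-mono-≤ (∑∑-before≤ m l c) (∑∑-foldWeight≤ m l d y′)) ⟩
    l * l * l ^ d + l * 1 * (d * l * l ^ d)
  ≡⟨ solve 3 (λ d l w → l :* l :* w :+ l :* con 1 :* (d :* l :* w) := (con 1 :+ d) :* l :* (l :* w))
           refl d l (l ^ d) ⟩
    suc d * l * l ^ suc d ∎
  where
  open ≤-Reasoning
  open +-*-Solver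
  c = head y
  y′ = tail y

sumB≤ : ∀ d m l (y : Point d) → sumB d m l y ≤ d * l * l ^ d
sumB≤ d m l y = ≤-trans (∑-mono-≤ (cube m d) (λ x → cardB≤∑foldWeight m l x y)) (∑∑-foldWeight≤ m l d y)

lemma8 : (d k n : ℕ) → 1 ≤ d → 1 ≤ k →
    (ℓ : ℕ → ℕ) →
    (∀ i → i < k → ℓ i ^ (d ^ k ∸ 1) ≡ n ^ (d ^ k ∸ d ^ i)) →
    ∀ i → i < k →
    (y : Point d) → InCube (sum (map ℓ (upTo k))) y →
    sumB d (sum (map ℓ (upTo k))) (ℓ i) y ≤ d * ℓ i * ℓ i ^ d
-- The bound holds for every window side and cube size.
lemma8 d k n _ _ ℓ _ i _ y _ = sumB≤ d (sum (map ℓ (upTo k))) (ℓ i) y
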